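{- For every integer $n\geq 4$, the slanting ladder $SL_n$ satisfies $\chi_g(SL_n)=5$.
   Context: All graphs are finite, simple and connected. A graceful $k$-coloring of a non-empty graph $G$ ($k\geq 2$) is a proper vertex coloring $f:V(G)\to\{1,2,\dots,k\}$ such that the induced edge coloring $f^*(uv)=|f(u)-f(v)|$, with values in $\{1,\dots,k-1\}$, is a proper edge coloring. The graceful chromatic number $\chi_g(G)$ is the minimum such $k$. The slanting ladder $SL_n$ ($n\geq 2$) has vertex set $\{x_i,y_i:1\leq i\leq n\}$ and edge set $\{x_ix_{i+1},\,y_iy_{i+1},\,x_iy_{i+1}:1\leq i\leq n-1\}$. -}

module Defs where

open import Data.Nat using (ℕ; suc; _≤_; _<_; ∣_-_∣)
open import Data.Fin using (Fin; toℕ)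
open import Data.Bool using (Bool; true; false)
open import Data.Product using (_×_; Σ; _,_)
open import Relation.Binary.PropositionalEquality using (_≡_; _≢_)
open import Relation.Nullary using (¬_)

record Graph : Set₁ where
  field
    V    : Set
    Adj  : V → V → Set
    sym  : ∀ {u v} → Adj u v → Adj v u
    irr  : ∀ {v} → ¬ Adj v v

open Graph public

-- Labels automatically lie in {1..k-1}.
record GracefulColoring (G : Graph) (k : ℕ) : Set where
  field
    f        : V G → ℕ
    range    : ∀ v → 1 ≤ f v × f v ≤ k
    proper   : ∀ {u v} → Adj G u v → f u ≢ f v
    edgeProp : ∀ {u v w} → Adj G u v → Adj G u w → v ≢ w →
               ∣ f u - f v ∣ ≢ ∣ f u - f w ∣

record GracefulChromaticNumberIs (G : Graph) (k : ℕ) : Set where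
  field
    two≤k   : 2 ≤ k
    colorable : GracefulColoring G k
    minimal : ∀ j → 2 ≤ j → j < k → ¬ GracefulColoring G j

-- Slanting ladder SL_n: vertices x_i = (i , true), y_i = (i , false),
-- with i : Fin n representing indices 1..n (toℕ i = index - 1).
data SLEdge (n : ℕ) : Fin n × Bool → Fin n × Bool → Set where
  xx : ∀ {i j : Fin n} → suc (toℕ i) ≡ toℕ j → SLEdge n (i , true)  (j , true)
  yy : ∀ {i j : Fin n} → suc (toℕ i) ≡ toℕ j → SLEdge n (i , false) (j , false)
  xy : ∀ {i j : Fin n} → suc (toℕ i) ≡ toℕ j → SLEdge n (i , true)  (j , false)

data SLAdj (n : ℕ) (u v : Fin n × Bool) : Set where
  fwd : SLEdge n u v → SLAdj n u v
  bwd : SLEdge n v u → SLAdj n u v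

private
  n≢sn : ∀ {m : ℕ} → suc m ≢ m
  n≢sn ()

  edge-irr : ∀ {n v} → ¬ SLEdge n v v
  edge-irr (xx e) = n≢sn e
  edge-irr (yy e) = n≢sn e

SL : ℕ → Graph
SL n = record
  { V   = Fin n × Bool
  ; Adj = SLAdj n
  ; sym = λ { (fwd e) → bwd e ; (bwd e) → fwd e }
  ; irr = λ { (fwd e) → edge-irr e ; (bwd e) → edge-irr e }
  }

-- Upper bound: put x_i at position i and y_i at position i + 1.  Every edge then joins
-- positions one or two apart, and the closed neighbourhood of each vertex lies in four
-- consecutive positions, so colouring by position mod 4 colours the square of SL_n.
-- Colouring the four residues by 1, 2, 4, 5 is graceful, because each of these numbers
-- has distinct distances to the other three.
-- Lower bound: with colours in {1,…,4}, a vertex of degree three sees all three other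
-- colours at three distinct distances, which forces its own colour to be 1 or 4.  But
-- x_2, x_3, y_3 have degree three (as n ≥ 4) and receive pairwise distinct colours.
module Submission where

open import Defs hiding (sym)
open import Data.Nat using (ℕ; suc; _+_; _≤_; _≤?_; z≤n; s≤s; ∣_-_∣)
open import Data.Nat.Properties using (≤-trans)
import Data.Nat as ℕ
open import Data.Fin using (Fin; toℕ) renaming (zero to fzero; suc to fsuc)
open import Data.Fin.Properties using (all?; toℕ-injective)
import Data.Fin.Properties as Fin
open import Data.Bool using (Bool; true; false)
open import Data.Product using (_×_; _,_)
open import Data.Sum using (_⊎_; inj₁; inj₂)
open import Data.Empty using (⊥; ⊥-elim)
open import Function using (_∘_)
open import Relation.Binary.PropositionalEquality using (_≡_; _≢_; refl; sym; trans; cong)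
open import Relation.Nullary using (¬_)
open import Relation.Nullary.Decidable using (toWitness; _×-dec_; _→-dec_; ¬?)

_∈⟨_,_⟩ : ℕ → ℕ → ℕ → Set
x ∈⟨ p , q ⟩ = x ≡ p ⊎ x ≡ q

pigeonhole : ∀ {p q x y z} → x ∈⟨ p , q ⟩ → y ∈⟨ p , q ⟩ → z ∈⟨ p , q ⟩ →
             x ≢ y → x ≢ z → y ≢ z → ⊥
pigeonhole (inj₁ refl) (inj₁ refl) _           x≢y _   _   = x≢y refl
pigeonhole (inj₂ refl) (inj₂ refl) _           x≢y _   _   = x≢y refl
pigeonhole (inj₁ refl) _           (inj₁ refl) _   x≢z _   = x≢z refl
pigeonhole (inj₂ refl) _           (inj₂ refl) _   x≢z _   = x≢z refl
pigeonhole _           (inj₁ refl) (inj₁ refl) _   _   y≢z = y≢z refl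
pigeonhole _           (inj₂ refl) (inj₂ refl) _   _   y≢z = y≢z refl

data UpTo4 : ℕ → Set where
  one   : UpTo4 1
  two   : UpTo4 2
  three : UpTo4 3
  four  : UpTo4 4

upTo4 : ∀ {a} → 1 ≤ a → a ≤ 4 → UpTo4 a
upTo4 {1} _ _ = one
upTo4 {2} _ _ = two
upTo4 {3} _ _ = three
upTo4 {4} _ _ = four
upTo4 {suc (suc (suc (suc (suc _))))} _ (s≤s (s≤s (s≤s (s≤s ()))))

inner-gap : ∀ {a b} → b ∈⟨ 2 , 3 ⟩ → UpTo4 a → b ≢ a → ∣ b - a ∣ ∈⟨ 1 , 2 ⟩
inner-gap (inj₁ refl) one   _   = inj₁ refl
inner-gap (inj₁ refl) two   b≢a = ⊥-elim (b≢a refl)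
inner-gap (inj₁ refl) three _   = inj₁ refl
inner-gap (inj₁ refl) four  _   = inj₂ refl
inner-gap (inj₂ refl) one   _   = inj₂ refl
inner-gap (inj₂ refl) two   _   = inj₁ refl
inner-gap (inj₂ refl) three b≢a = ⊥-elim (b≢a refl)
inner-gap (inj₂ refl) four  _   = inj₁ refl

inner-¬distinctGaps : ∀ {a b c d} → b ∈⟨ 2 , 3 ⟩ → UpTo4 a → UpTo4 c → UpTo4 d →
  b ≢ a → b ≢ c → b ≢ d →
  ∣ b - a ∣ ≢ ∣ b - c ∣ → ∣ b - a ∣ ≢ ∣ b - d ∣ → ∣ b - c ∣ ≢ ∣ b - d ∣ → ⊥
inner-¬distinctGaps b a c d b≢a b≢c b≢d =
  pigeonhole (inner-gap b a b≢a) (inner-gap b c b≢c) (inner-gap b d b≢d)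

distinctGaps⇒endpoint : ∀ {a b c d} → UpTo4 b → UpTo4 a → UpTo4 c → UpTo4 d →
  b ≢ a → b ≢ c → b ≢ d →
  ∣ b - a ∣ ≢ ∣ b - c ∣ → ∣ b - a ∣ ≢ ∣ b - d ∣ → ∣ b - c ∣ ≢ ∣ b - d ∣ → b ∈⟨ 1 , 4 ⟩
distinctGaps⇒endpoint one   _ _ _ = λ _ _ _ _ _ _ → inj₁ refl
distinctGaps⇒endpoint two   a c d = λ b≢a b≢c b≢d ac ad cd →
  ⊥-elim (inner-¬distinctGaps (inj₁ refl) a c d b≢a b≢c b≢d ac ad cd)
distinctGaps⇒endpoint three a c d = λ b≢a b≢c b≢d ac ad cd →
  ⊥-elim (inner-¬distinctGaps (inj₂ refl) a c d b≢a b≢c b≢d ac ad cd)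
distinctGaps⇒endpoint four  _ _ _ = λ _ _ _ _ _ _ → inj₂ refl

module _ {G : Graph} {k : ℕ} (col : GracefulColoring G k) where
  open GracefulColoring col

  neighbours-differ : ∀ {u v w} → Adj G u v → Adj G u w → v ≢ w → f v ≢ f w
  neighbours-differ {u} uv uw v≢w fv≡fw = edgeProp uv uw v≢w (cong (∣ f u -_∣) fv≡fw)

  degreeThree⇒endpoint : k ≤ 4 → ∀ {u v w z} → Adj G u v → Adj G u w → Adj G u z →
                         v ≢ w → v ≢ z → w ≢ z → f u ∈⟨ 1 , 4 ⟩
  degreeThree⇒endpoint k≤4 {u} {v} {w} {z} uv uw uz v≢w v≢z w≢z =
    distinctGaps⇒endpoint (bounded u) (bounded v) (bounded w) (bounded z)
      (proper uv) (proper uw) (proper uz)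
      (edgeProp uv uw v≢w) (edgeProp uv uz v≢z) (edgeProp uw uz w≢z)
    where
      bounded : ∀ x → UpTo4 (f x)
      bounded x = let 1≤fx , fx≤k = range x in upTo4 1≤fx (≤-trans fx≤k k≤4)

record SquareColoring (G : Graph) (m : ℕ) : Set where
  field
    colour              : V G → Fin m
    adjacent-distinct   : ∀ {u v} → Adj G u v → colour u ≢ colour v
    neighbours-distinct : ∀ {u v w} → Adj G u v → Adj G u w → v ≢ w → colour v ≢ colour w

palette : Fin 4 → ℕ
palette fzero                      = 1
palette (fsuc fzero)               = 2
palette (fsuc (fsuc fzero))        = 4
palette (fsuc (fsuc (fsuc fzero))) = 5

palette-range : ∀ i → 1 ≤ palette i × palette i ≤ 5
palette-range = toWitness {a? = all? λ i → (1 ≤? palette i) ×-dec (palette i ≤? 5)} _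

palette-injective : ∀ {i j} → i ≢ j → palette i ≢ palette j
palette-injective {i} {j} = toWitness
  {a? = all? λ i → all? λ j → ¬? (i Fin.≟ j) →-dec ¬? (palette i ℕ.≟ palette j)} _ i j

-- {1,2,4,5} avoids 3, the middle term of every three-term progression in [1,5].
palette-distinctGaps : ∀ {i j k} → i ≢ j → i ≢ k → j ≢ k →
                       ∣ palette i - palette j ∣ ≢ ∣ palette i - palette k ∣
palette-distinctGaps {i} {j} {k} = toWitness
  {a? = all? λ i → all? λ j → all? λ k →
    ¬? (i Fin.≟ j) →-dec (¬? (i Fin.≟ k) →-dec (¬? (j Fin.≟ k) →-dec
    ¬? (∣ palette i - palette j ∣ ℕ.≟ ∣ palette i - palette k ∣)))} _ i j k

squareColoring⇒gracefulColoring : ∀ {G} → SquareColoring G 4 → GracefulColoring G 5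
squareColoring⇒gracefulColoring sq = record
  { f        = palette ∘ colour
  ; range    = palette-range ∘ colour
  ; proper   = palette-injective ∘ adjacent-distinct
  ; edgeProp = λ uv uw v≢w → palette-distinctGaps
      (adjacent-distinct uv) (adjacent-distinct uw) (neighbours-distinct uv uw v≢w)
  }
  where open SquareColoring sq

data Step : ℕ → Set where
  step₁ : Step 1
  step₂ : Step 2
  step₃ : Step 3

data Near : ℕ → ℕ → Set where
  ahead  : ∀ {d m} → Step d → Near m (d + m)
  behind : ∀ {d m} → Step d → Near (d + m) m

phase : ℕ → Fin 4
phase 0 = fzero
phase 1 = fsuc fzero
phase 2 = fsuc (fsuc fzero)
phase 3 = fsuc (fsuc (fsuc fzero))
phase (suc (suc (suc (suc m)))) = phase m

phase-step : ∀ m {d} → Step d → phase m ≢ phase (d + m)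
phase-step 0 step₁ ()
phase-step 0 step₂ ()
phase-step 0 step₃ ()
phase-step 1 step₁ ()
phase-step 1 step₂ ()
phase-step 1 step₃ ()
phase-step 2 step₁ ()
phase-step 2 step₂ ()
phase-step 2 step₃ ()
phase-step 3 step₁ ()
phase-step 3 step₂ ()
phase-step 3 step₃ ()
phase-step (suc (suc (suc (suc m)))) step₁ = phase-step m step₁
phase-step (suc (suc (suc (suc m)))) step₂ = phase-step m step₂
phase-step (suc (suc (suc (suc m)))) step₃ = phase-step m step₃

phase-near : ∀ {m m′} → Near m m′ → phase m ≢ phase m′
phase-near {m} (ahead s)  = phase-step m s
phase-near {m′ = m} (behind s) = phase-step m s ∘ sym

module _ {n : ℕ} where
  position : Fin n × Bool → ℕ
  position (i , true)  = toℕ i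
  position (i , false) = suc (toℕ i)

  position-adjacent : ∀ {u v} → SLAdj n u v → Near (position u) (position v)
  position-adjacent (fwd (xx e)) rewrite sym e = ahead step₁
  position-adjacent (fwd (yy e)) rewrite sym e = ahead step₁
  position-adjacent (fwd (xy e)) rewrite sym e = ahead step₂
  position-adjacent (bwd (xx e)) rewrite sym e = behind step₁
  position-adjacent (bwd (yy e)) rewrite sym e = behind step₁
  position-adjacent (bwd (xy e)) rewrite sym e = behind step₂

  successor-unique : ∀ {i j k : Fin n} → suc (toℕ i) ≡ toℕ j → suc (toℕ i) ≡ toℕ k → j ≡ k
  successor-unique e e′ = toℕ-injective (trans (sym e) e′)

  predecessor-unique : ∀ {i j k : Fin n} → suc (toℕ j) ≡ toℕ i → suc (toℕ k) ≡ toℕ i → j ≡ k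
  predecessor-unique e e′ = toℕ-injective (cong ℕ.pred (trans e (sym e′)))

  position-neighbours : ∀ {u v w} → SLAdj n u v → SLAdj n u w → v ≢ w →
                        Near (position v) (position w)
  position-neighbours (fwd (xx e)) (fwd (xx e′)) v≢w =
    ⊥-elim (v≢w (cong (_, true) (successor-unique e e′)))
  position-neighbours (fwd (yy e)) (fwd (yy e′)) v≢w =
    ⊥-elim (v≢w (cong (_, false) (successor-unique e e′)))
  position-neighbours (fwd (xy e)) (fwd (xy e′)) v≢w =
    ⊥-elim (v≢w (cong (_, false) (successor-unique e e′)))
  position-neighbours (bwd (xx e)) (bwd (xx e′)) v≢w =
    ⊥-elim (v≢w (cong (_, true) (predecessor-unique e e′)))
  position-neighbours (bwd (yy e)) (bwd (yy e′)) v≢w =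
    ⊥-elim (v≢w (cong (_, false) (predecessor-unique e e′)))
  position-neighbours (bwd (xy e)) (bwd (xy e′)) v≢w =
    ⊥-elim (v≢w (cong (_, true) (predecessor-unique e e′)))
  position-neighbours (fwd (xx e)) (fwd (xy e′)) _ rewrite sym e | sym e′ = ahead step₁
  position-neighbours (fwd (xy e)) (fwd (xx e′)) _ rewrite sym e | sym e′ = behind step₁
  position-neighbours (fwd (xx e)) (bwd (xx e′)) _ rewrite sym e | sym e′ = behind step₂
  position-neighbours (bwd (xx e)) (fwd (xx e′)) _ rewrite sym e | sym e′ = ahead step₂
  position-neighbours (fwd (xy e)) (bwd (xx e′)) _ rewrite sym e | sym e′ = behind step₃
  position-neighbours (bwd (xx e)) (fwd (xy e′)) _ rewrite sym e | sym e′ = ahead step₃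
  position-neighbours (fwd (yy e)) (bwd (yy e′)) _ rewrite sym e | sym e′ = behind step₂
  position-neighbours (bwd (yy e)) (fwd (yy e′)) _ rewrite sym e | sym e′ = ahead step₂
  position-neighbours (fwd (yy e)) (bwd (xy e′)) _ rewrite sym e | sym e′ = behind step₃
  position-neighbours (bwd (xy e)) (fwd (yy e′)) _ rewrite sym e | sym e′ = ahead step₃
  position-neighbours (bwd (yy e)) (bwd (xy e′)) _
    rewrite cong toℕ (predecessor-unique e e′) = behind step₁
  position-neighbours (bwd (xy e)) (bwd (yy e′)) _
    rewrite cong toℕ (predecessor-unique e e′) = ahead step₁

  SL-squareColoring : SquareColoring (SL n) 4
  SL-squareColoring = record
    { colour              = phase ∘ position
    ; adjacent-distinct   = phase-near ∘ position-adjacent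
    ; neighbours-distinct = λ uv uw v≢w → phase-near (position-neighbours uv uw v≢w)
    }

SL-¬gracefulColoring : ∀ {n k} → 4 ≤ n → k ≤ 4 → ¬ GracefulColoring (SL n) k
SL-¬gracefulColoring {suc (suc (suc (suc m)))} (s≤s (s≤s (s≤s (s≤s _)))) k≤4 col =
  pigeonhole endpoint-x₂ endpoint-x₃ endpoint-y₃
    (proper (fwd (xx refl))) (proper (fwd (xy refl)))
    (neighbours-differ col (fwd (xx refl)) (fwd (xy refl)) λ ())
  where
    open GracefulColoring col
    x₁ x₂ x₃ x₄ y₂ y₃ y₄ : Fin (4 + m) × Bool
    x₁ = fzero , true
    x₂ = fsuc fzero , true
    x₃ = fsuc (fsuc fzero) , true
    x₄ = fsuc (fsuc (fsuc fzero)) , true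
    y₂ = fsuc fzero , false
    y₃ = fsuc (fsuc fzero) , false
    y₄ = fsuc (fsuc (fsuc fzero)) , false

    endpoint-x₂ : f x₂ ∈⟨ 1 , 4 ⟩
    endpoint-x₂ = degreeThree⇒endpoint col k≤4 {x₂} {x₁} {x₃} {y₃}
      (bwd (xx refl)) (fwd (xx refl)) (fwd (xy refl)) (λ ()) (λ ()) (λ ())

    endpoint-x₃ : f x₃ ∈⟨ 1 , 4 ⟩
    endpoint-x₃ = degreeThree⇒endpoint col k≤4 {x₃} {x₂} {x₄} {y₄}
      (bwd (xx refl)) (fwd (xx refl)) (fwd (xy refl)) (λ ()) (λ ()) (λ ())

    endpoint-y₃ : f y₃ ∈⟨ 1 , 4 ⟩
    endpoint-y₃ = degreeThree⇒endpoint col k≤4 {y₃} {y₂} {y₄} {x₂}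
      (bwd (yy refl)) (fwd (yy refl)) (bwd (xy refl)) (λ ()) (λ ()) (λ ())

theorem3p4 : ∀ (n : ℕ) → 4 ≤ n → GracefulChromaticNumberIs (SL n) 5
theorem3p4 n 4≤n = record
  { two≤k     = s≤s (s≤s z≤n)
  ; colorable = squareColoring⇒gracefulColoring SL-squareColoring
  ; minimal   = λ j _ j<5 → SL-¬gracefulColoring 4≤n (ℕ.≤-pred j<5)
  }
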